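{- Let $w$ be a nonempty finite balanced word over $\{a,b\}$ and let $k>0$ be an integer. Then both $|w|_a$ and $|w|_b$ are divisible by $k$ if and only if $w$ is an abelian $k$-power.
   Context: $|w|_x$ denotes the number of occurrences of the letter $x$ in $w$, and the Parikh vector of $w$ is $P(w)=(|w|_a,|w|_b)$. A word $w$ over $\{a,b\}$ is balanced if for every two factors $u,u'$ of $w$ of the same length, $\big||u|_a-|u'|_a\big|\le 1$. An abelian $k$-power is a nonempty word $v_1v_2\cdots v_k$ where all $v_i$ have the same Parikh vector. -}

module Defs where

open import Data.Nat using (ℕ; zero; suc; _+_; _≤_; ∣_-_∣)
open import Data.List using (List; []; _∷_; _++_; length; concat)
open import Data.Vec using (Vec; toList)
open import Data.Product using (_×_; _,_; ∃; ∃-syntax; Σ-syntax)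
open import Relation.Binary.PropositionalEquality using (_≡_)

data Letter : Set where
  a b : Letter

Word : Set
Word = List Letter

count : Letter → Word → ℕ
count x [] = 0
count a (a ∷ w) = suc (count a w)
count a (b ∷ w) = count a w
count b (a ∷ w) = count b w
count b (b ∷ w) = suc (count b w)

parikh : Word → ℕ × ℕ
parikh w = count a w , count b w

Factor : Word → Word → Set
Factor u w = ∃[ p ] ∃[ s ] (w ≡ p ++ u ++ s)

Balanced : Word → Set
Balanced w = ∀ u u' → Factor u w → Factor u' w → length u ≡ length u' →
             ∣ count a u - count a u' ∣ ≤ 1

NonEmpty : Word → Set
NonEmpty w = ∃[ x ] ∃[ w' ] (w ≡ x ∷ w')

AbelianPower : ℕ → Word → Set
AbelianPower k w =
  NonEmpty w ×
  (Σ[ vs ∈ Vec Word k ] (w ≡ concat (toList vs)) ×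
     (∀ i j → parikh (Data.Vec.lookup vs i) ≡ parikh (Data.Vec.lookup vs j)))

module Submission where

-- Counting a's and b's is additive over concatenation, so an
-- abelian k-power w = v₁⋯v_k has |w|_x = k·|v₁|_x and both counts are
-- divisible by k.  Conversely, if |w|_a = k·p and |w|_b = k·q, cut w into k
-- consecutive blocks of length m = p + q.  The blocks are factors of w of the
-- same length, so by balance their a-counts pairwise differ by at most 1; and
-- these counts sum to k·p.  A vector of naturals whose entries pairwise differ
-- by at most 1 and whose sum is n·p must be constantly p (if one entry were
-- below p, all would be ≤ p and the sum would fall short; symmetrically from
-- above).  So every block has p a's and length m, hence Parikh vector (p, q).

open import Defs
open import Data.Nat using (ℕ; zero; suc; _+_; _*_; _∸_; _≤_; _<_; z≤n; s≤s; ∣_-_∣)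
open import Data.Nat.Properties
open import Data.Nat.Divisibility using (_∣_; divides; m∣m*n)
open import Data.List using ([]; _∷_; _++_; length; concat; take; drop)
open import Data.List.Properties using (take++drop≡id; length-take; length-drop; ++-assoc; ++-identityʳ)
open import Data.Vec using (Vec; toList; lookup; map; sum; replicate) renaming ([] to []ᵥ; _∷_ to _∷ᵥ_)
open import Data.Vec.Properties using (lookup-map; lookup-replicate)
open import Data.Fin using () renaming (zero to fzero; suc to fsuc)
open import Data.Product using (_×_; _,_; proj₁; proj₂)
open import Data.Empty using (⊥-elim)
open import Relation.Binary.PropositionalEquality
open import Function.Bundles using (_⇔_; mk⇔)
open import Relation.Binary.Definitions using (tri<; tri≈; tri>)

count-++ : ∀ x u v → count x (u ++ v) ≡ count x u + count x v
count-++ x [] v = refl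
count-++ a (a ∷ u) v = cong suc (count-++ a u v)
count-++ a (b ∷ u) v = count-++ a u v
count-++ b (a ∷ u) v = count-++ b u v
count-++ b (b ∷ u) v = cong suc (count-++ b u v)

length-count : ∀ u → length u ≡ count a u + count b u
length-count [] = refl
length-count (a ∷ u) = cong suc (length-count u)
length-count (b ∷ u) = trans (cong suc (length-count u)) (sym (+-suc (count a u) (count b u)))

parikh-from-length : ∀ u v → length u ≡ length v → count a u ≡ count a v → parikh u ≡ parikh v
parikh-from-length u v len≡ a≡ = cong₂ _,_ a≡ (+-cancelˡ-≡ (count a v) _ _ (begin
    count a v + count b u  ≡⟨ cong (_+ count b u) (sym a≡) ⟩
    count a u + count b u  ≡⟨ sym (length-count u) ⟩
    length u               ≡⟨ len≡ ⟩
    length v               ≡⟨ length-count v ⟩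
    count a v + count b v  ∎))
  where open ≡-Reasoning

count-concat : ∀ {n} x (vs : Vec Word n) → count x (concat (toList vs)) ≡ sum (map (count x) vs)
count-concat x []ᵥ = refl
count-concat x (u ∷ᵥ vs) = trans (count-++ x u _) (cong (count x u +_) (count-concat x vs))

sum-mono-≤ : ∀ {n} (xs ys : Vec ℕ n) → (∀ i → lookup xs i ≤ lookup ys i) → sum xs ≤ sum ys
sum-mono-≤ []ᵥ []ᵥ le = z≤n
sum-mono-≤ (x ∷ᵥ xs) (y ∷ᵥ ys) le = +-mono-≤ (le fzero) (sum-mono-≤ xs ys (λ i → le (fsuc i)))

sum-mono-< : ∀ {n} (xs ys : Vec ℕ n) → (∀ i → lookup xs i ≤ lookup ys i) →
             ∀ j → lookup xs j < lookup ys j → sum xs < sum ys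
sum-mono-< (x ∷ᵥ xs) (y ∷ᵥ ys) le fzero lt = +-mono-<-≤ lt (sum-mono-≤ xs ys (λ i → le (fsuc i)))
sum-mono-< (x ∷ᵥ xs) (y ∷ᵥ ys) le (fsuc j) lt = +-mono-≤-< (le fzero) (sum-mono-< xs ys (λ i → le (fsuc i)) j lt)

sum-replicate : ∀ n c → sum (replicate n c) ≡ n * c
sum-replicate zero c = refl
sum-replicate (suc n) c = cong (c +_) (sum-replicate n c)

sum-constant : ∀ {n} (ns : Vec ℕ n) c → (∀ i → lookup ns i ≡ c) → sum ns ≡ n * c
sum-constant {n} ns c all≡ = trans (≤-antisym (sum-mono-≤ ns cs (λ i → ≤-reflexive (to i)))
                                              (sum-mono-≤ cs ns (λ i → ≤-reflexive (sym (to i)))))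
                                   (sum-replicate n c)
  where
  cs = replicate n c
  to : ∀ i → lookup ns i ≡ lookup cs i
  to i = trans (all≡ i) (sym (lookup-replicate i c))

∣-∣≤1⇒≤suc : ∀ x y → ∣ x - y ∣ ≤ 1 → x ≤ suc y
∣-∣≤1⇒≤suc zero y h = z≤n
∣-∣≤1⇒≤suc (suc zero) zero h = s≤s z≤n
∣-∣≤1⇒≤suc (suc (suc x)) zero (s≤s ())
∣-∣≤1⇒≤suc (suc x) (suc y) h = s≤s (∣-∣≤1⇒≤suc x y h)

sum-<-const : ∀ {n} (ns : Vec ℕ n) c → (∀ j → lookup ns j ≤ c) → ∀ i → lookup ns i < c → sum ns < n * c
sum-<-const {n} ns c le i lt = subst (sum ns <_) (sum-replicate n c)
  (sum-mono-< ns (replicate n c) (λ j → subst (_ ≤_) (sym (lookup-replicate j c)) (le j))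
              i (subst (_ <_) (sym (lookup-replicate i c)) lt))

sum->-const : ∀ {n} (ns : Vec ℕ n) c → (∀ j → c ≤ lookup ns j) → ∀ i → c < lookup ns i → n * c < sum ns
sum->-const {n} ns c le i lt = subst (_< sum ns) (sum-replicate n c)
  (sum-mono-< (replicate n c) ns (λ j → subst (_≤ _) (sym (lookup-replicate j c)) (le j))
              i (subst (_< _) (sym (lookup-replicate i c)) lt))

near-constant : ∀ {n} (ns : Vec ℕ n) p → sum ns ≡ n * p →
                (∀ i j → ∣ lookup ns i - lookup ns j ∣ ≤ 1) → ∀ i → lookup ns i ≡ p
near-constant ns p total close i with <-cmp (lookup ns i) p
... | tri≈ _ eq _ = eq
... | tri< below _ _ = ⊥-elim (<-irrefl total (sum-<-const ns p all-≤ i below))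
  where
  -- every entry is at most one more than the entry below p
  all-≤ : ∀ j → lookup ns j ≤ p
  all-≤ j = ≤-trans (∣-∣≤1⇒≤suc _ _ (close j i)) below
... | tri> _ _ above = ⊥-elim (<-irrefl (sym total) (sum->-const ns p all-≥ i above))
  where
  -- every entry is at least one less than the entry above p
  all-≥ : ∀ j → p ≤ lookup ns j
  all-≥ j = ≤-pred (≤-trans above (∣-∣≤1⇒≤suc _ _ (close i j)))

blocks : (k : ℕ) → ℕ → Word → Vec Word (suc k)
blocks zero m w = w ∷ᵥ []ᵥ
blocks (suc k) m w = take m w ∷ᵥ blocks k m (drop m w)

concat-blocks : ∀ k m w → concat (toList (blocks k m w)) ≡ w
concat-blocks zero m w = ++-identityʳ w
concat-blocks (suc k) m w = trans (cong (take m w ++_) (concat-blocks k m (drop m w))) (take++drop≡id m w)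

length-blocks : ∀ k m w → length w ≡ suc k * m → ∀ i → length (lookup (blocks k m w) i) ≡ m
length-blocks zero m w len fzero = trans len (+-identityʳ m)
length-blocks (suc k) m w len fzero =
  trans (length-take m w) (m≤n⇒m⊓n≡m (subst (m ≤_) (sym len) (m≤m+n m _)))
length-blocks (suc k) m w len (fsuc i) =
  length-blocks k m (drop m w) (trans (length-drop m w) (trans (cong (_∸ m) len) (m+n∸m≡n m (suc k * m)))) i

-- Every block of w is a factor of pre ++ w (the prefix is needed for the induction).
block-factor : ∀ k m w pre i → Factor (lookup (blocks k m w) i) (pre ++ w)
block-factor zero m w pre fzero = pre , [] , cong (pre ++_) (sym (++-identityʳ w))
block-factor (suc k) m w pre fzero = pre , drop m w , cong (pre ++_) (sym (take++drop≡id m w))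
block-factor (suc k) m w pre (fsuc i) with block-factor k m (drop m w) (pre ++ take m w) i
... | p , s , eq = p , s , trans regroup eq
  where
  regroup : pre ++ w ≡ (pre ++ take m w) ++ drop m w
  regroup = trans (cong (pre ++_) (sym (take++drop≡id m w))) (sym (++-assoc pre (take m w) (drop m w)))

abelian-power⇒divisible : ∀ k w → AbelianPower (suc k) w → (suc k ∣ count a w) × (suc k ∣ count b w)
abelian-power⇒divisible k w (_ , vs , w≡ , same) =
  divisible a (λ i → cong proj₁ (same i fzero)) , divisible b (λ i → cong proj₂ (same i fzero))
  where
  divisible : ∀ x → (∀ i → count x (lookup vs i) ≡ count x (lookup vs fzero)) → suc k ∣ count x w
  divisible x as-first = subst (suc k ∣_) (sym total) (m∣m*n _)
    where
    entries : ∀ i → lookup (map (count x) vs) i ≡ count x (lookup vs fzero)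
    entries i = trans (lookup-map i (count x) vs) (as-first i)
    total : count x w ≡ suc k * count x (lookup vs fzero)
    total = trans (cong (count x) w≡) (trans (count-concat x vs) (sum-constant (map (count x) vs) _ entries))

balanced-divisible⇒abelian-power : ∀ k w → NonEmpty w → Balanced w →
  (suc k ∣ count a w) × (suc k ∣ count b w) → AbelianPower (suc k) w
balanced-divisible⇒abelian-power k w ne bal (divides p a≡ , divides q b≡) =
  ne , vs , sym (concat-blocks k m w) , λ i j → parikh-from-length (lookup vs i) (lookup vs j) (len-same i j) (a-same i j)
  where
  m = p + q
  vs = blocks k m w
  as = map (count a) vs
  open ≡-Reasoning
  length-w : length w ≡ suc k * m
  length-w = begin
    length w                ≡⟨ length-count w ⟩
    count a w + count b w   ≡⟨ cong₂ _+_ a≡ b≡ ⟩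
    p * suc k + q * suc k   ≡⟨ sym (*-distribʳ-+ (suc k) p q) ⟩
    m * suc k               ≡⟨ *-comm m (suc k) ⟩
    suc k * m               ∎
  len-same : ∀ i j → length (lookup vs i) ≡ length (lookup vs j)
  len-same i j = trans (length-blocks k m w length-w i) (sym (length-blocks k m w length-w j))
  as-sum : sum as ≡ suc k * p
  as-sum = begin
    sum as                         ≡⟨ sym (count-concat a vs) ⟩
    count a (concat (toList vs))   ≡⟨ cong (count a) (concat-blocks k m w) ⟩
    count a w                      ≡⟨ a≡ ⟩
    p * suc k                      ≡⟨ *-comm p (suc k) ⟩
    suc k * p                      ∎
  as-close : ∀ i j → ∣ lookup as i - lookup as j ∣ ≤ 1
  as-close i j rewrite lookup-map i (count a) vs | lookup-map j (count a) vs =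
    bal _ _ (block-factor k m w [] i) (block-factor k m w [] j) (len-same i j)
  a-is-p : ∀ i → count a (lookup vs i) ≡ p
  a-is-p i = trans (sym (lookup-map i (count a) vs)) (near-constant as p as-sum as-close i)
  a-same : ∀ i j → count a (lookup vs i) ≡ count a (lookup vs j)
  a-same i j = trans (a-is-p i) (sym (a-is-p j))

lemma11 : (w : Word) → NonEmpty w → Balanced w → (k : ℕ) → 0 < k →
    ((k ∣ count a w) × (k ∣ count b w)) ⇔ AbelianPower k w
lemma11 w ne bal (suc k) _ =
  mk⇔ (balanced-divisible⇒abelian-power k w ne bal) (abelian-power⇒divisible k w)
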